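{- For every even integer $\ell \geq 6$ with $\ell \equiv 0 \pmod 6$, the twisted product $C_3 \,\tilde{\square}\, C_\ell$ (of order $3\ell$) is a nut graph.
   Context: Label the vertices of the cycle $C_k$ by $0,\dots,k-1$ and of $C_\ell$ by $0,\dots,\ell-1$, consecutive labels (modulo the length) being adjacent. The cartesian product $C_k \,\square\, C_\ell$ has vertex set $\{(i,j)\}$ with $(i,j)\sim(i',j')$ iff ($i,i'$ adjacent in $C_k$ and $j=j'$) or ($i=i'$ and $j,j'$ adjacent in $C_\ell$). The twisted product $C_k \,\tilde{\square}\, C_\ell$ has the same vertex set and edge set $E(C_k \,\square\, C_\ell) \setminus \{ (i,0)(i,1) : 0 \le i < k\} \cup \{ (i,0)((i+1) \bmod k, 1) : 0 \le i < k\}$. A nut graph is a simple connected graph whose adjacency matrix has one-dimensional kernel spanned by a vector with no zero entry.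
   Formalization: The kernel of the adjacency matrix in the definition of a nut graph is taken over ℚ. -}

module Defs where

open import Data.Nat using (ℕ; zero; suc; _≡ᵇ_)
open import Data.Bool using (Bool; true; false; _∧_; _∨_; not; if_then_else_; T)
open import Data.Fin using (Fin; toℕ; remQuot)
open import Data.Product using (_×_; _,_; ∃; Σ)
open import Data.Rational using (ℚ; 0ℚ; 1ℚ; _+_; _*_)
open import Relation.Binary.PropositionalEquality using (_≡_; _≢_)
open import Relation.Nullary using (¬_)

sucMod : ℕ → ℕ → ℕ
sucMod m a = if suc a ≡ᵇ m then 0 else suc a

cycAdj : (m : ℕ) → Fin m → Fin m → Bool
cycAdj m a b = (sucMod m (toℕ a) ≡ᵇ toℕ b) ∨ (sucMod m (toℕ b) ≡ᵇ toℕ a)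

finEq : ∀ {m} → Fin m → Fin m → Bool
finEq a b = toℕ a ≡ᵇ toℕ b

cartAdj : (k ℓ : ℕ) → Fin k × Fin ℓ → Fin k × Fin ℓ → Bool
cartAdj k ℓ (i , j) (i' , j') =
  (cycAdj k i i' ∧ finEq j j') ∨ (finEq i i' ∧ cycAdj ℓ j j')

removedEdge : (k ℓ : ℕ) → Fin k × Fin ℓ → Fin k × Fin ℓ → Bool
removedEdge k ℓ (i , j) (i' , j') =
  finEq i i' ∧ (((toℕ j ≡ᵇ 0) ∧ (toℕ j' ≡ᵇ 1)) ∨ ((toℕ j ≡ᵇ 1) ∧ (toℕ j' ≡ᵇ 0)))

addedEdge : (k ℓ : ℕ) → Fin k × Fin ℓ → Fin k × Fin ℓ → Bool
addedEdge k ℓ (i , j) (i' , j') =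
  ((toℕ j ≡ᵇ 0) ∧ (toℕ j' ≡ᵇ 1) ∧ (sucMod k (toℕ i) ≡ᵇ toℕ i'))
  ∨ ((toℕ j' ≡ᵇ 0) ∧ (toℕ j ≡ᵇ 1) ∧ (sucMod k (toℕ i') ≡ᵇ toℕ i))

twistedAdjPair : (k ℓ : ℕ) → Fin k × Fin ℓ → Fin k × Fin ℓ → Bool
twistedAdjPair k ℓ u v = (cartAdj k ℓ u v ∧ not (removedEdge k ℓ u v)) ∨ addedEdge k ℓ u v

twistedProduct : (k ℓ : ℕ) → Fin (k Data.Nat.* ℓ) → Fin (k Data.Nat.* ℓ) → Bool
twistedProduct k ℓ u v = twistedAdjPair k ℓ (remQuot ℓ u) (remQuot ℓ v)

Adjacency : ℕ → Set
Adjacency n = Fin n → Fin n → Bool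

IsSimple : ∀ {n} → Adjacency n → Set
IsSimple {n} A = (∀ (u v : Fin n) → A u v ≡ A v u) × (∀ (u : Fin n) → A u u ≡ false)

data Walk {n : ℕ} (A : Adjacency n) : Fin n → Fin n → Set where
  here : ∀ {u} → Walk A u u
  step : ∀ {u v w} → T (A u v) → Walk A v w → Walk A u w

IsConnected : ∀ {n} → Adjacency n → Set
IsConnected {n} A = ∀ (u v : Fin n) → Walk A u v

Σℚ : ∀ n → (Fin n → ℚ) → ℚ
Σℚ zero f = 0ℚ
Σℚ (suc n) f = f Fin.zero + Σℚ n (λ i → f (Fin.suc i))
  where import Data.Fin as Fin

entry : Bool → ℚ
entry true = 1ℚ
entry false = 0ℚ

InKernel : ∀ {n} → Adjacency n → (Fin n → ℚ) → Set
InKernel {n} A x = ∀ (u : Fin n) → Σℚ n (λ v → entry (A u v) * x v) ≡ 0ℚ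

IsNutGraph : ∀ {n} → Adjacency n → Set
IsNutGraph {n} A =
  IsSimple A × IsConnected A ×
  Σ (Fin n → ℚ) (λ x →
    InKernel A x × (∀ (u : Fin n) → x u ≢ 0ℚ) ×
    (∀ (y : Fin n → ℚ) → InKernel A y → ∃ λ (c : ℚ) → ∀ (u : Fin n) → y u ≡ c * x u))

{-# OPTIONS --safe #-}
module Submission where

-- Write a vector on C₃ ~□ C_ℓ as three rows indexed by the C_ℓ coordinate. Rotating the rows is
-- an automorphism, so for a kernel vector y the difference of y and its rotation is again in the
-- kernel and has vanishing column sums. For such a vector the equations away from columns 0 and 1
-- say that each row satisfies f (j + 2) = f (j + 1) - f j, a recurrence of period 6; as 6 ∣ ℓ,
-- the equations at columns 0 and 1, whose twisted edges pass to the neighbouring row, then force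
-- the entries there to agree in all three rows, hence to vanish (3 is invertible), and the
-- difference is zero. So y is constant on columns and its
-- row is a (-2)-eigenvector of C_ℓ: f (j + 2) + 2 f (j + 1) + f j = 0 gives
-- f j = (-1)^j (f 0 - j (f 0 + f 1)), and closing up the cycle forces f 0 + f 1 = 0. Conversely
-- the alternating vector (-1)^j lies in the kernel because ℓ is even.

open import Defs
open import Data.Nat as ℕ using (ℕ; zero; suc; _≡ᵇ_; _≤_; s≤s; z≤n)
import Data.Nat.Properties as ℕ
open import Data.Nat.Divisibility using (_∣_; divides; ∣-trans)
open import Data.Bool using (Bool; true; false; _∧_; _∨_; not; if_then_else_; T)
import Data.Bool.Properties as Bool
open import Data.Fin as Fin using (Fin; toℕ; combine; remQuot; fromℕ<; _↑ˡ_; _↑ʳ_)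
open import Data.Fin.Patterns using (0F; 1F; 2F)
import Data.Fin.Properties as Fin
open import Data.Sum using (inj₁; inj₂)
open import Data.Product using (_×_; _,_; proj₁; proj₂; ∃)
open import Data.Rational as ℚ using (ℚ; 0ℚ; 1ℚ; _+_; _*_; _-_; -_)
import Data.Rational.Properties as ℚ
open import Algebra.Definitions.RawMonoid ℚ.+-0-rawMonoid using () renaming (_×_ to _·_)
open import Algebra.Bundles using (CommutativeMonoid)
open import Algebra.Properties.CommutativeSemigroup
  (CommutativeMonoid.commutativeSemigroup ℚ.+-0-commutativeMonoid) using (interchange)
open import Algebra.Properties.Group ℚ.+-0-group using () renaming (⁻¹-involutive to neg-involutive)
open import Function using (_∘_)
open import Relation.Binary.PropositionalEquality
open import Relation.Binary.Definitions using (tri<; tri≈; tri>)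
open import Data.Unit using (tt)
open import Relation.Nullary using (contradiction)
open import Relation.Nullary.Decidable using (dec-true; dec-false; dec⇒maybe)
open import Tactic.RingSolver using (solve-∀)
open import Tactic.RingSolver.Core.AlmostCommutativeRing using (AlmostCommutativeRing; fromCommutativeRing)

ℚ-ring : AlmostCommutativeRing _ _
ℚ-ring = fromCommutativeRing ℚ.+-*-commutativeRing (λ x → dec⇒maybe (0ℚ ℚ.≟ x))

≡ᵇ-refl : ∀ n → (n ≡ᵇ n) ≡ true
≡ᵇ-refl n = dec-true (n ℕ.≟ n) refl

≢⇒≡ᵇ-false : ∀ {m n} → m ≢ n → (m ≡ᵇ n) ≡ false
≢⇒≡ᵇ-false {m} {n} = dec-false (m ℕ.≟ n)

≡ᵇ-sym : ∀ m n → (m ≡ᵇ n) ≡ (n ≡ᵇ m)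
≡ᵇ-sym zero    zero    = refl
≡ᵇ-sym zero    (suc n) = refl
≡ᵇ-sym (suc m) zero    = refl
≡ᵇ-sym (suc m) (suc n) = ≡ᵇ-sym m n

padding-elim : ∀ b → ((b ∨ false) ∧ true) ∨ false ≡ b
padding-elim true  = refl
padding-elim false = refl

sucMod-< : ∀ {m n} → suc n ℕ.< m → sucMod m n ≡ suc n
sucMod-< {m} {n} p = cong (if_then 0 else suc n) (≢⇒≡ᵇ-false (ℕ.<⇒≢ p))

sucMod-last : ∀ n → sucMod (suc n) n ≡ 0
sucMod-last n = cong (if_then 0 else suc n) (≡ᵇ-refl n)

sucMod-bounded : ∀ {m n} → n ℕ.< m → sucMod m n ℕ.< m
sucMod-bounded {m} {n} n<m with ℕ.m≤n⇒m<n∨m≡n n<m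
... | inj₁ 1+n<m = subst (ℕ._< m) (sym (sucMod-< 1+n<m)) 1+n<m
... | inj₂ refl  = subst (ℕ._< suc n) (sym (sucMod-last n)) (s≤s z≤n)

sucMod-≢ : ∀ m n {k} → k ≢ 0 → k ≢ suc n → sucMod m n ≢ k
sucMod-≢ m n k≢0 k≢1+n with suc n ≡ᵇ m
... | true  = k≢0 ∘ sym
... | false = k≢1+n ∘ sym

sucMod-≡ᵇ-suc : ∀ {m n k} → n ℕ.< m → suc k ℕ.< m → (sucMod m n ≡ᵇ suc k) ≡ (n ≡ᵇ k)
sucMod-≡ᵇ-suc {m} {n} {k} n<m k<m with suc n ≡ᵇ m in eq
... | true  = sym (≢⇒≡ᵇ-false {n} {k} λ { refl → ℕ.<-irrefl (ℕ.≡ᵇ⇒≡ _ _ (subst T (sym eq) _)) k<m })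
... | false = refl

·-nonNeg : ∀ n {x} → 0ℚ ℚ.≤ x → 0ℚ ℚ.≤ n · x
·-nonNeg zero    _   = ℚ.≤-refl
·-nonNeg (suc n) 0≤x = ℚ.+-mono-≤ 0≤x (·-nonNeg n 0≤x)

·-nonPos : ∀ n {x} → x ℚ.≤ 0ℚ → n · x ℚ.≤ 0ℚ
·-nonPos zero    _   = ℚ.≤-refl
·-nonPos (suc n) x≤0 = ℚ.+-mono-≤ x≤0 (·-nonPos n x≤0)

·-cancel : ∀ n {x} → suc n · x ≡ 0ℚ → x ≡ 0ℚ
·-cancel n {x} e with ℚ.<-cmp x 0ℚ
... | tri< x<0 _ _ = contradiction (ℚ.+-mono-<-≤ x<0 (·-nonPos n (ℚ.<⇒≤ x<0))) (ℚ.<-irrefl e)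
... | tri≈ _ x≡0 _ = x≡0
... | tri> _ _ 0<x = contradiction (ℚ.+-mono-<-≤ 0<x (·-nonNeg n (ℚ.<⇒≤ 0<x))) (ℚ.<-irrefl (sym e))

·-zeroʳ : ∀ n → n · 0ℚ ≡ 0ℚ
·-zeroʳ zero    = refl
·-zeroʳ (suc n) = trans (ℚ.+-identityˡ (n · 0ℚ)) (·-zeroʳ n)

sign : ℕ → ℚ
sign zero    = 1ℚ
sign (suc n) = - sign n

sign≢0 : ∀ n → sign n ≢ 0ℚ
sign≢0 zero    ()
sign≢0 (suc n) e = sign≢0 n (ℚ.neg-injective e)

sign-even : ∀ {n} → 2 ∣ n → sign n ≡ 1ℚ
sign-even (divides q refl) = sign-2* q
  where
  sign-2* : ∀ q → sign (q ℕ.* 2) ≡ 1ℚ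
  sign-2* zero    = refl
  sign-2* (suc q) = trans (neg-involutive (sign (q ℕ.* 2))) (sign-2* q)

sign-sucMod : ∀ {m} n → 2 ∣ m → sign (sucMod m n) ≡ - sign n
sign-sucMod {m} n 2∣m with suc n ≡ᵇ m in eq
... | true  = sym (sign-even {suc n} (subst (2 ∣_) (sym (ℕ.≡ᵇ⇒≡ _ _ (subst T (sym eq) _))) 2∣m))
... | false = refl

by-zero : ∀ {p r s} → r ≡ p + s → p ≡ 0ℚ → r ≡ s
by-zero r≡p+s refl = trans r≡p+s (ℚ.+-identityˡ _)

sub-interchange : ∀ a b c d → (a - c) + (b - d) ≡ (a + b) - (c + d)
sub-interchange a b c d = trans (interchange a (- c) b (- d)) (cong (a + b +_) (sym (ℚ.neg-distrib-+ c d)))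

cancel-column : ∀ {a b c d x} → a + b + c + d ≡ 0ℚ → x + c + d ≡ 0ℚ → a ≡ x - b
cancel-column {a} {b} {c} {d} {x} e₁ e₂ = by-zero (identity a b c d x) (cong₂ _-_ e₁ e₂)
  where
  identity : ∀ a b c d x → a ≡ (a + b + c + d) - (x + c + d) + (x - b)
  identity = solve-∀ ℚ-ring

Σℚ-cong : ∀ n {f g : Fin n → ℚ} → (∀ i → f i ≡ g i) → Σℚ n f ≡ Σℚ n g
Σℚ-cong zero    f≗g = refl
Σℚ-cong (suc n) f≗g = cong₂ _+_ (f≗g Fin.zero) (Σℚ-cong n (f≗g ∘ Fin.suc))

Σℚ-zero : ∀ n → Σℚ n (λ _ → 0ℚ) ≡ 0ℚ
Σℚ-zero zero    = refl
Σℚ-zero (suc n) = trans (ℚ.+-identityˡ _) (Σℚ-zero n)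

Σℚ-+ : ∀ n (f g : Fin n → ℚ) → Σℚ n (λ i → f i + g i) ≡ Σℚ n f + Σℚ n g
Σℚ-+ zero    f g = refl
Σℚ-+ (suc n) f g = trans (cong (f Fin.zero + g Fin.zero +_) (Σℚ-+ n (f ∘ Fin.suc) (g ∘ Fin.suc)))
                         (interchange (f Fin.zero) (g Fin.zero) (Σℚ n (f ∘ Fin.suc)) (Σℚ n (g ∘ Fin.suc)))

Σℚ-↑ : ∀ m n (f : Fin (m ℕ.+ n) → ℚ) → Σℚ (m ℕ.+ n) f ≡ Σℚ m (f ∘ (_↑ˡ n)) + Σℚ n (f ∘ (m ↑ʳ_))
Σℚ-↑ zero    n f = sym (ℚ.+-identityˡ _)
Σℚ-↑ (suc m) n f = trans (cong (f Fin.zero +_) (Σℚ-↑ m n (f ∘ Fin.suc))) (sym (ℚ.+-assoc (f Fin.zero) _ _))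

Σℚ-combine : ∀ k ℓ (f : Fin (k ℕ.* ℓ) → ℚ) → Σℚ (k ℕ.* ℓ) f ≡ Σℚ k (λ i → Σℚ ℓ (λ j → f (combine i j)))
Σℚ-combine zero    ℓ f = refl
Σℚ-combine (suc k) ℓ f =
  trans (Σℚ-↑ ℓ (k ℕ.* ℓ) f) (cong (Σℚ ℓ (f ∘ (_↑ˡ (k ℕ.* ℓ))) +_) (Σℚ-combine k ℓ (f ∘ (ℓ ↑ʳ_))))

lookupℕ : ∀ {n} → (Fin n → ℚ) → ℕ → ℚ
lookupℕ {zero}  g _       = 0ℚ
lookupℕ {suc n} g zero    = g Fin.zero
lookupℕ {suc n} g (suc m) = lookupℕ (g ∘ Fin.suc) m

lookupℕ-toℕ : ∀ {n} (g : Fin n → ℚ) j → lookupℕ g (toℕ j) ≡ g j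
lookupℕ-toℕ g Fin.zero    = refl
lookupℕ-toℕ g (Fin.suc j) = lookupℕ-toℕ (g ∘ Fin.suc) j

lookupℕ-≗ : ∀ {n} {g : Fin n → ℚ} (f : ℕ → ℚ) → (∀ j → g j ≡ f (toℕ j)) →
  ∀ {m} → m ℕ.< n → lookupℕ g m ≡ f m
lookupℕ-≗ {suc n} f g≗f {zero}  _         = g≗f Fin.zero
lookupℕ-≗ {suc n} f g≗f {suc m} (s≤s m<n) = lookupℕ-≗ (f ∘ suc) (g≗f ∘ Fin.suc) m<n

entry-false : ∀ x → entry false * x ≡ 0ℚ
entry-false = ℚ.*-zeroˡ

entry-∨ : ∀ p q x → (p ≡ true → q ≡ false) → entry (p ∨ q) * x ≡ entry p * x + entry q * x
entry-∨ true  true  x disjoint with () ← disjoint refl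
entry-∨ true  false x _        = sym (trans (cong (entry true * x +_) (entry-false x)) (ℚ.+-identityʳ _))
entry-∨ false q     x _        = sym (trans (cong (_+ entry q * x) (entry-false x)) (ℚ.+-identityˡ _))

Σℚ-select : ∀ {n} (g : Fin n → ℚ) a → Σℚ n (λ j → entry (toℕ j ≡ᵇ a) * g j) ≡ lookupℕ g a
Σℚ-select {zero}  g a       = refl
Σℚ-select {suc n} g zero    = begin
  entry true * g Fin.zero + Σℚ n (λ j → entry false * g (Fin.suc j))
    ≡⟨ cong₂ _+_ (ℚ.*-identityˡ (g Fin.zero)) (trans (Σℚ-cong n (entry-false ∘ g ∘ Fin.suc)) (Σℚ-zero n)) ⟩
  g Fin.zero + 0ℚ
    ≡⟨ ℚ.+-identityʳ _ ⟩
  g Fin.zero ∎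
  where open ≡-Reasoning
Σℚ-select {suc n} g (suc a) =
  trans (cong₂ _+_ (entry-false (g Fin.zero)) (Σℚ-select (g ∘ Fin.suc) a)) (ℚ.+-identityˡ _)

Σℚ-select₂ : ∀ {n} (g : Fin n → ℚ) {a b} → a ≢ b →
  Σℚ n (λ j → entry ((toℕ j ≡ᵇ a) ∨ (toℕ j ≡ᵇ b)) * g j) ≡ lookupℕ g a + lookupℕ g b
Σℚ-select₂ {n} g {a} {b} a≢b = begin
  Σℚ n (λ j → entry ((toℕ j ≡ᵇ a) ∨ (toℕ j ≡ᵇ b)) * g j)
    ≡⟨ Σℚ-cong n (λ j → entry-∨ _ _ (g j) (disjoint (toℕ j))) ⟩
  Σℚ n (λ j → entry (toℕ j ≡ᵇ a) * g j + entry (toℕ j ≡ᵇ b) * g j)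
    ≡⟨ Σℚ-+ n _ _ ⟩
  Σℚ n (λ j → entry (toℕ j ≡ᵇ a) * g j) + Σℚ n (λ j → entry (toℕ j ≡ᵇ b) * g j)
    ≡⟨ cong₂ _+_ (Σℚ-select g a) (Σℚ-select g b) ⟩
  lookupℕ g a + lookupℕ g b ∎
  where
  open ≡-Reasoning
  disjoint : ∀ m → (m ≡ᵇ a) ≡ true → (m ≡ᵇ b) ≡ false
  disjoint m m≡ᵇa = ≢⇒≡ᵇ-false {m} {b} λ { refl → a≢b (sym (ℕ.≡ᵇ⇒≡ m a (subst T (sym m≡ᵇa) _))) }

_◅◅_ : ∀ {n} {A : Adjacency n} {u v w} → Walk A u v → Walk A v w → Walk A u w
here     ◅◅ q = q
step e p ◅◅ q = step e (p ◅◅ q)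

reverse : ∀ {n} {A : Adjacency n} → (∀ u v → A u v ≡ A v u) → ∀ {u v} → Walk A u v → Walk A v u
reverse A-sym here               = here
reverse A-sym (step {u} {v} e p) = reverse A-sym p ◅◅ step (subst T (A-sym u v) e) here

connected-via-hub : ∀ {n} {A : Adjacency n} → (∀ u v → A u v ≡ A v u) →
  (hub : Fin n) → (∀ u → Walk A u hub) → IsConnected A
connected-via-hub A-sym hub to-hub u v = to-hub u ◅◅ reverse A-sym (to-hub v)

cycAdj-sym : ∀ m (a b : Fin m) → cycAdj m a b ≡ cycAdj m b a
cycAdj-sym m a b = Bool.∨-comm (sucMod m (toℕ a) ≡ᵇ toℕ b) _

finEq-sym : ∀ {m} (a b : Fin m) → finEq a b ≡ finEq b a
finEq-sym a b = ≡ᵇ-sym (toℕ a) (toℕ b)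

cartAdj-sym : ∀ k ℓ u v → cartAdj k ℓ u v ≡ cartAdj k ℓ v u
cartAdj-sym k ℓ (i , j) (i′ , j′) =
  cong₂ _∨_ (cong₂ _∧_ (cycAdj-sym k i i′) (finEq-sym j j′)) (cong₂ _∧_ (finEq-sym i i′) (cycAdj-sym ℓ j j′))

removedEdge-sym : ∀ k ℓ u v → removedEdge k ℓ u v ≡ removedEdge k ℓ v u
removedEdge-sym k ℓ (i , j) (i′ , j′) = cong₂ _∧_ (finEq-sym i i′) (begin
  ((b ≡ᵇ 0) ∧ (b′ ≡ᵇ 1)) ∨ ((b ≡ᵇ 1) ∧ (b′ ≡ᵇ 0))   ≡⟨ Bool.∨-comm ((b ≡ᵇ 0) ∧ (b′ ≡ᵇ 1)) _ ⟩
  ((b ≡ᵇ 1) ∧ (b′ ≡ᵇ 0)) ∨ ((b ≡ᵇ 0) ∧ (b′ ≡ᵇ 1))   ≡⟨ cong₂ _∨_ (Bool.∧-comm (b ≡ᵇ 1) _) (Bool.∧-comm (b ≡ᵇ 0) _) ⟩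
  ((b′ ≡ᵇ 0) ∧ (b ≡ᵇ 1)) ∨ ((b′ ≡ᵇ 1) ∧ (b ≡ᵇ 0))   ∎)
  where
  open ≡-Reasoning
  b b′ : ℕ
  b  = toℕ j
  b′ = toℕ j′

addedEdge-sym : ∀ k ℓ u v → addedEdge k ℓ u v ≡ addedEdge k ℓ v u
addedEdge-sym k ℓ (i , j) (i′ , j′) =
  Bool.∨-comm ((toℕ j ≡ᵇ 0) ∧ (toℕ j′ ≡ᵇ 1) ∧ (sucMod k (toℕ i) ≡ᵇ toℕ i′)) _

twistedAdjPair-sym : ∀ k ℓ u v → twistedAdjPair k ℓ u v ≡ twistedAdjPair k ℓ v u
twistedAdjPair-sym k ℓ u v = cong₂ _∨_
  (cong₂ _∧_ (cartAdj-sym k ℓ u v) (cong not (removedEdge-sym k ℓ u v))) (addedEdge-sym k ℓ u v)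

-- The cyclic group of order three

next prev : Fin 3 → Fin 3
next 0F = 1F
next 1F = 2F
next 2F = 0F
prev 0F = 2F
prev 1F = 0F
prev 2F = 1F

prev-next : ∀ i → prev (next i) ≡ i
prev-next 0F = refl
prev-next 1F = refl
prev-next 2F = refl

Σℚ-rotate : ∀ (f : Fin 3 → ℚ) i → Σℚ 3 f ≡ f i + f (next i) + f (prev i)
Σℚ-rotate f 0F = rotate₀ (f 0F) (f 1F) (f 2F)
  where
  rotate₀ : ∀ a b c → a + (b + (c + 0ℚ)) ≡ a + b + c
  rotate₀ = solve-∀ ℚ-ring
Σℚ-rotate f 1F = rotate₁ (f 0F) (f 1F) (f 2F)
  where
  rotate₁ : ∀ a b c → a + (b + (c + 0ℚ)) ≡ b + c + a
  rotate₁ = solve-∀ ℚ-ring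
Σℚ-rotate f 2F = rotate₂ (f 0F) (f 1F) (f 2F)
  where
  rotate₂ : ∀ a b c → a + (b + (c + 0ℚ)) ≡ c + a + b
  rotate₂ = solve-∀ ℚ-ring

rotation-invariant⇒0 : (u : Fin 3 → ℚ) → (∀ i → u (next i) ≡ u i) → u 0F + u 1F + u 2F ≡ 0ℚ →
  ∀ i → u i ≡ 0ℚ
rotation-invariant⇒0 u inv sum≡0 i = trans (constant i) (·-cancel 2 (begin
  3 · u 0F             ≡⟨ triple (u 0F) ⟩
  u 0F + u 0F + u 0F   ≡⟨ cong₂ (λ a b → u 0F + a + b) (sym (constant 1F)) (sym (constant 2F)) ⟩
  u 0F + u 1F + u 2F   ≡⟨ sum≡0 ⟩
  0ℚ                   ∎))
  where
  open ≡-Reasoning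
  triple : ∀ x → x + (x + (x + 0ℚ)) ≡ x + x + x
  triple = solve-∀ ℚ-ring
  constant : ∀ i → u i ≡ u 0F
  constant 0F = refl
  constant 1F = inv 0F
  constant 2F = trans (inv 1F) (inv 0F)

-- Two linear recurrences

module _ {f : ℕ → ℚ} {N : ℕ} (rec : ∀ j → 2 ℕ.+ j ℕ.< N → f (2 ℕ.+ j) ≡ f (1 ℕ.+ j) - f j) where

  recurrence-antiperiodic : ∀ j → 3 ℕ.+ j ℕ.< N → f (3 ℕ.+ j) ≡ - f j
  recurrence-antiperiodic j 3+j<N = begin
    f (3 ℕ.+ j)                       ≡⟨ rec (1 ℕ.+ j) 3+j<N ⟩
    f (2 ℕ.+ j) - f (1 ℕ.+ j)         ≡⟨ cong (_- f (1 ℕ.+ j)) (rec j (ℕ.m+n≤o⇒n≤o 1 3+j<N)) ⟩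
    f (1 ℕ.+ j) - f j - f (1 ℕ.+ j)   ≡⟨ cancel (f (1 ℕ.+ j)) (f j) ⟩
    - f j                             ∎
    where
    open ≡-Reasoning
    cancel : ∀ x y → x - y - x ≡ - y
    cancel = solve-∀ ℚ-ring

  recurrence-period-6 : ∀ j → 6 ℕ.+ j ℕ.< N → f (6 ℕ.+ j) ≡ f j
  recurrence-period-6 j 6+j<N = begin
    f (6 ℕ.+ j)       ≡⟨ recurrence-antiperiodic (3 ℕ.+ j) 6+j<N ⟩
    - f (3 ℕ.+ j)     ≡⟨ cong -_ (recurrence-antiperiodic j (ℕ.m+n≤o⇒n≤o 3 6+j<N)) ⟩
    - (- f j)         ≡⟨ neg-involutive (f j) ⟩
    f j               ∎
    where open ≡-Reasoning

  recurrence-ends : ∀ k → 4 ℕ.+ k ℕ.* 6 ℕ.< N → f (4 ℕ.+ k ℕ.* 6) ≡ - f 1 × f (3 ℕ.+ k ℕ.* 6) ≡ - f 0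
  recurrence-ends zero    4<N = recurrence-antiperiodic 1 4<N , recurrence-antiperiodic 0 (ℕ.m+n≤o⇒n≤o 1 4<N)
  recurrence-ends (suc k) p   =
    trans (recurrence-period-6 (4 ℕ.+ k ℕ.* 6) p) (proj₁ ends) ,
    trans (recurrence-period-6 (3 ℕ.+ k ℕ.* 6) (ℕ.m+n≤o⇒n≤o 1 p)) (proj₂ ends)
    where ends = recurrence-ends k (ℕ.m+n≤o⇒n≤o 6 p)

  recurrence-vanishing : f 0 ≡ 0ℚ → f 1 ≡ 0ℚ → ∀ j → j ℕ.< N → f j ≡ 0ℚ
  recurrence-vanishing f0≡0 f1≡0 zero    _   = f0≡0
  recurrence-vanishing f0≡0 f1≡0 (suc j) 1+j<N = proj₂ (consecutive j 1+j<N)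
    where
    consecutive : ∀ j → 1 ℕ.+ j ℕ.< N → f j ≡ 0ℚ × f (1 ℕ.+ j) ≡ 0ℚ
    consecutive zero    _ = f0≡0 , f1≡0
    consecutive (suc j) p with consecutive j (ℕ.m+n≤o⇒n≤o 1 p)
    ... | fj≡0 , f1+j≡0 = f1+j≡0 , trans (rec j p) (cong₂ _-_ f1+j≡0 fj≡0)

recurrence-ends-6∣ : ∀ {f : ℕ → ℚ} r → 6 ∣ 3 ℕ.+ r →
  (∀ j → 2 ℕ.+ j ℕ.< 2 ℕ.+ r → f (2 ℕ.+ j) ≡ f (1 ℕ.+ j) - f j) →
  f (1 ℕ.+ r) ≡ - f 1 × f r ≡ - f 0
recurrence-ends-6∣ r (divides zero    ())
recurrence-ends-6∣ {f} r (divides (suc k) 3+r≡6+6k) rec with ℕ.+-cancelˡ-≡ 3 r _ 3+r≡6+6k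
... | refl = recurrence-ends {f} rec k (ℕ.n<1+n _)

module _ {a : ℕ → ℚ} {M : ℕ}
  (rec : ∀ j → 2 ℕ.+ j ℕ.≤ M → a (2 ℕ.+ j) + a j + a (1 ℕ.+ j) + a (1 ℕ.+ j) ≡ 0ℚ) where

  alternating-closed-form : ∀ j → j ℕ.≤ M → a j ≡ sign j * (a 0 - j · (a 0 + a 1))
  alternating-closed-form zero    _     = sym (trans (ℚ.*-identityˡ (a 0 - 0ℚ)) (ℚ.+-identityʳ (a 0)))
  alternating-closed-form (suc j) 1+j≤M = proj₂ (consecutive j 1+j≤M)
    where
    advance : ∀ {x₀ x₁ x₂} s X S a₀ → x₀ ≡ s * (a₀ - X) → x₁ ≡ (- s) * (a₀ - (S + X)) →
              x₂ + x₀ + x₁ + x₁ ≡ 0ℚ → x₂ ≡ (- (- s)) * (a₀ - (S + (S + X)))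
    advance {x₂ = x₂} s X S a₀ refl refl = by-zero (identity s X S a₀ x₂)
      where
      identity : ∀ s X S a₀ x₂ → x₂ ≡ (x₂ + s * (a₀ - X) + (- s) * (a₀ - (S + X)) + (- s) * (a₀ - (S + X)))
                                        + (- (- s)) * (a₀ - (S + (S + X)))
      identity = solve-∀ ℚ-ring
    second : ∀ x y → y ≡ (- 1ℚ) * (x - ((x + y) + 0ℚ))
    second = solve-∀ ℚ-ring
    consecutive : ∀ j → 1 ℕ.+ j ℕ.≤ M →
      a j ≡ sign j * (a 0 - j · (a 0 + a 1)) × a (1 ℕ.+ j) ≡ sign (1 ℕ.+ j) * (a 0 - (1 ℕ.+ j) · (a 0 + a 1))
    consecutive zero    _ = alternating-closed-form 0 z≤n , second (a 0) (a 1)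
    consecutive (suc j) 2+j≤M with consecutive j (ℕ.<⇒≤ 2+j≤M)
    ... | aj , a1+j = a1+j , advance (sign j) (j · (a 0 + a 1)) (a 0 + a 1) (a 0) aj a1+j (rec j 2+j≤M)

  cycle-alternating : 2 ∣ suc M → a M + (a 0 + a 1) + a 0 ≡ 0ℚ → ∀ j → j ℕ.≤ M → a j ≡ sign j * a 0
  cycle-alternating 2∣1+M closing j j≤M = begin
    a j                       ≡⟨ alternating-closed-form j j≤M ⟩
    sign j * (a 0 - j · S)    ≡⟨ cong (λ x → sign j * (a 0 - j · x)) S≡0 ⟩
    sign j * (a 0 - j · 0ℚ)   ≡⟨ cong (λ x → sign j * (a 0 - x)) (·-zeroʳ j) ⟩
    sign j * (a 0 - 0ℚ)       ≡⟨ cong (sign j *_) (ℚ.+-identityʳ (a 0)) ⟩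
    sign j * a 0              ∎
    where
    open ≡-Reasoning
    S : ℚ
    S = a 0 + a 1
    sign-M : sign M ≡ - 1ℚ
    sign-M = trans (sym (neg-involutive (sign M))) (cong -_ (sign-even 2∣1+M))
    a-M : a M ≡ (- 1ℚ) * (a 0 - M · S)
    a-M = trans (alternating-closed-form M ℕ.≤-refl) (cong (_* (a 0 - M · S)) sign-M)
    closing-sum : ∀ {aM} → aM ≡ (- 1ℚ) * (a 0 - M · S) → suc M · S ≡ aM + S + a 0
    closing-sum refl = identity (a 0) (a 1) (M · S)
      where
      identity : ∀ x y X → (x + y) + X ≡ (- 1ℚ) * (x - X) + (x + y) + x
      identity = solve-∀ ℚ-ring
    S≡0 : S ≡ 0ℚ
    S≡0 = ·-cancel M (trans (closing-sum a-M) closing)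

-- The twisted product C₃ ~□ C_ℓ

-- Parametrised by ℓ - 3 so that sucMod ℓ and _≡ᵇ ℓ compute on the small numerals that occur
-- in the row characterisations below.

module TwistedC₃ (ℓ-3 : ℕ) where

  ℓ ℓ-1 : ℕ
  ℓ   = 3 ℕ.+ ℓ-3
  ℓ-1 = 2 ℕ.+ ℓ-3

  A : Adjacency (3 ℕ.* ℓ)
  A = twistedProduct 3 ℓ

  cell : Fin 3 → Fin ℓ → Fin (3 ℕ.* ℓ)
  cell = combine

  A-cell : ∀ i j i′ j′ → A (cell i j) (cell i′ j′) ≡ twistedAdjPair 3 ℓ (i , j) (i′ , j′)
  A-cell i j i′ j′ = cong₂ (twistedAdjPair 3 ℓ) (Fin.remQuot-combine i j) (Fin.remQuot-combine i′ j′)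

  every-cell : ∀ {P : Fin (3 ℕ.* ℓ) → Set} → (∀ i j → P (cell i j)) → ∀ u → P u
  every-cell {P} P-cell u =
    subst P (Fin.combine-remQuot {3} ℓ u) (P-cell (proj₁ (remQuot {3} ℓ u)) (proj₂ (remQuot {3} ℓ u)))

  sameRowAdj nextRowAdj prevRowAdj : ℕ → ℕ → Bool
  sameRowAdj 0             m = m ≡ᵇ ℓ-1
  sameRowAdj 1             m = m ≡ᵇ 2
  sameRowAdj (suc (suc k)) m = (m ≡ᵇ sucMod ℓ (2 ℕ.+ k)) ∨ (m ≡ᵇ suc k)
  nextRowAdj 0       m = (m ≡ᵇ 0) ∨ (m ≡ᵇ 1)
  nextRowAdj (suc k) m = m ≡ᵇ suc k
  prevRowAdj 1 m = (m ≡ᵇ 1) ∨ (m ≡ᵇ 0)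
  prevRowAdj n m = m ≡ᵇ n

  -- Adjacency between rows i and i + d is the same Boolean expression for every i, so the cases
  -- i = 1, 2 reduce to i = 0 by computation.
  adj-sameRow : ∀ i (j j′ : Fin ℓ) → twistedAdjPair 3 ℓ (i , j) (i , j′) ≡ sameRowAdj (toℕ j) (toℕ j′)
  adj-sameRow 0F = row₀
    where
    row₀ : ∀ (j j′ : Fin ℓ) → twistedAdjPair 3 ℓ (0F , j) (0F , j′) ≡ sameRowAdj (toℕ j) (toℕ j′)
    row₀ 0F 0F = refl
    row₀ 0F 1F = refl
    row₀ 0F (Fin.suc (Fin.suc r)) with toℕ r ≡ᵇ ℓ-3
    ... | true  = refl
    ... | false = refl
    row₀ 1F 0F = refl
    row₀ 1F 1F = refl
    row₀ 1F 2F = refl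
    row₀ 1F (Fin.suc (Fin.suc (Fin.suc r))) with suc (toℕ r) ≡ᵇ ℓ-3
    ... | true  = refl
    ... | false = refl
    row₀ j@(Fin.suc (Fin.suc r)) j′ =
      trans (cong₂ _∨_ (Bool.∧-identityʳ _) (Bool.∧-zeroʳ (toℕ j′ ≡ᵇ 0))) (trans (Bool.∨-identityʳ _)
        (cong₂ _∨_ (≡ᵇ-sym (sucMod ℓ (toℕ j)) (toℕ j′)) (sucMod-≡ᵇ-suc (Fin.toℕ<n j′) (Fin.toℕ<n j))))
  adj-sameRow 1F = adj-sameRow 0F
  adj-sameRow 2F = adj-sameRow 0F

  adj-nextRow : ∀ i (j j′ : Fin ℓ) → twistedAdjPair 3 ℓ (i , j) (next i , j′) ≡ nextRowAdj (toℕ j) (toℕ j′)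
  adj-nextRow 0F = row₀
    where
    row₀ : ∀ (j j′ : Fin ℓ) → twistedAdjPair 3 ℓ (0F , j) (1F , j′) ≡ nextRowAdj (toℕ j) (toℕ j′)
    row₀ 0F 0F = refl
    row₀ 0F 1F = refl
    row₀ 0F (Fin.suc (Fin.suc r)) = refl
    row₀ (Fin.suc j) 0F           = Bool.∧-zeroʳ (toℕ j ≡ᵇ 0)
    row₀ (Fin.suc j) (Fin.suc j′) = trans (padding-elim _) (≡ᵇ-sym (toℕ j) (toℕ j′))
  adj-nextRow 1F = adj-nextRow 0F
  adj-nextRow 2F = adj-nextRow 0F

  adj-prevRow : ∀ i (j j′ : Fin ℓ) → twistedAdjPair 3 ℓ (i , j) (prev i , j′) ≡ prevRowAdj (toℕ j) (toℕ j′)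
  adj-prevRow 0F = row₀
    where
    row₀ : ∀ (j j′ : Fin ℓ) → twistedAdjPair 3 ℓ (0F , j) (2F , j′) ≡ prevRowAdj (toℕ j) (toℕ j′)
    row₀ 0F 0F = refl
    row₀ 0F 1F = refl
    row₀ 0F (Fin.suc (Fin.suc r)) = refl
    row₀ 1F 0F = refl
    row₀ 1F 1F = refl
    row₀ 1F (Fin.suc (Fin.suc r)) = refl
    row₀ (Fin.suc (Fin.suc j)) 0F           = refl
    row₀ (Fin.suc (Fin.suc j)) (Fin.suc j′) = trans (padding-elim _) (≡ᵇ-sym (suc (toℕ j)) (toℕ j′))
  adj-prevRow 1F = adj-prevRow 0F
  adj-prevRow 2F = adj-prevRow 0F

  sameRowSum nextRowSum prevRowSum : (ℕ → ℚ) → ℕ → ℚ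
  sameRowSum f 0             = f ℓ-1
  sameRowSum f 1             = f 2
  sameRowSum f (suc (suc k)) = f (sucMod ℓ (2 ℕ.+ k)) + f (suc k)
  nextRowSum f 0       = f 0 + f 1
  nextRowSum f (suc k) = f (suc k)
  prevRowSum f 1 = f 1 + f 0
  prevRowSum f n = f n

  Σ-sameRow : ∀ (g : Fin ℓ → ℚ) n →
    Σℚ ℓ (λ j → entry (sameRowAdj n (toℕ j)) * g j) ≡ sameRowSum (lookupℕ g) n
  Σ-sameRow g 0             = Σℚ-select g ℓ-1
  Σ-sameRow g 1             = Σℚ-select g 2
  Σ-sameRow g (suc (suc k)) =
    Σℚ-select₂ g (sucMod-≢ ℓ (2 ℕ.+ k) (λ ()) (ℕ.<⇒≢ (ℕ.m<n+m (suc k) {2} (s≤s z≤n))))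

  Σ-nextRow : ∀ (g : Fin ℓ → ℚ) n →
    Σℚ ℓ (λ j → entry (nextRowAdj n (toℕ j)) * g j) ≡ nextRowSum (lookupℕ g) n
  Σ-nextRow g 0       = Σℚ-select₂ g {0} {1} (λ ())
  Σ-nextRow g (suc k) = Σℚ-select g (suc k)

  Σ-prevRow : ∀ (g : Fin ℓ → ℚ) n →
    Σℚ ℓ (λ j → entry (prevRowAdj n (toℕ j)) * g j) ≡ prevRowSum (lookupℕ g) n
  Σ-prevRow g 0             = Σℚ-select g 0
  Σ-prevRow g 1             = Σℚ-select₂ g {1} {0} (λ ())
  Σ-prevRow g (suc (suc k)) = Σℚ-select g (suc (suc k))

  nbrSum : (Fin 3 → ℕ → ℚ) → Fin 3 → ℕ → ℚ
  nbrSum h i n = sameRowSum (h i) n + nextRowSum (h (next i)) n + prevRowSum (h (prev i)) n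

  -- Entries beyond ℓ - 1 are the junk value 0, so facts about rows are stated for n < ℓ only.
  rows : (Fin (3 ℕ.* ℓ) → ℚ) → Fin 3 → ℕ → ℚ
  rows y i = lookupℕ {ℓ} (λ j → y (cell i j))

  Σ-neighbours : ∀ y i j → Σℚ (3 ℕ.* ℓ) (λ v → entry (A (cell i j) v) * y v) ≡ nbrSum (rows y) i (toℕ j)
  Σ-neighbours y i j = begin
    Σℚ (3 ℕ.* ℓ) (λ v → entry (A (cell i j) v) * y v)
      ≡⟨ Σℚ-combine 3 ℓ (λ v → entry (A (cell i j) v) * y v) ⟩
    Σℚ 3 (λ i′ → Σℚ ℓ (λ j′ → entry (A (cell i j) (cell i′ j′)) * y (cell i′ j′)))
      ≡⟨ Σℚ-cong 3 (λ i′ → Σℚ-cong ℓ (λ j′ → cong (λ b → entry b * y (cell i′ j′)) (A-cell i j i′ j′))) ⟩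
    Σℚ 3 rowSum
      ≡⟨ Σℚ-rotate rowSum i ⟩
    rowSum i + rowSum (next i) + rowSum (prev i)
      ≡⟨ cong₂ _+_ (cong₂ _+_ (via i        (sameRowAdj (toℕ j)) (adj-sameRow i j) (Σ-sameRow (row i) (toℕ j)))
                              (via (next i) (nextRowAdj (toℕ j)) (adj-nextRow i j) (Σ-nextRow (row (next i)) (toℕ j))))
                   (via (prev i) (prevRowAdj (toℕ j)) (adj-prevRow i j) (Σ-prevRow (row (prev i)) (toℕ j))) ⟩
    nbrSum (rows y) i (toℕ j) ∎
    where
    open ≡-Reasoning
    rowSum : Fin 3 → ℚ
    rowSum i′ = Σℚ ℓ (λ j′ → entry (twistedAdjPair 3 ℓ (i , j) (i′ , j′)) * y (cell i′ j′))
    row : Fin 3 → Fin ℓ → ℚ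
    row i′ j′ = y (cell i′ j′)
    via : ∀ i′ P {r} → (∀ j′ → twistedAdjPair 3 ℓ (i , j) (i′ , j′) ≡ P (toℕ j′)) →
          Σℚ ℓ (λ j′ → entry (P (toℕ j′)) * row i′ j′) ≡ r → rowSum i′ ≡ r
    via i′ P adj = trans (Σℚ-cong ℓ (λ j′ → cong (λ b → entry b * row i′ j′) (adj j′)))

  Balanced : (Fin 3 → ℕ → ℚ) → Set
  Balanced h = ∀ i n → n ℕ.< ℓ → nbrSum h i n ≡ 0ℚ

  inKernel⇒balanced : ∀ {y} → InKernel A y → Balanced (rows y)
  inKernel⇒balanced {y} y∈ker i n n<ℓ = begin
    nbrSum (rows y) i n                       ≡⟨ cong (nbrSum (rows y) i) (sym (Fin.toℕ-fromℕ< n<ℓ)) ⟩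
    nbrSum (rows y) i (toℕ (fromℕ< n<ℓ))      ≡⟨ sym (Σ-neighbours y i (fromℕ< n<ℓ)) ⟩
    Σℚ (3 ℕ.* ℓ) (λ v → entry (A (cell i (fromℕ< n<ℓ)) v) * y v) ≡⟨ y∈ker (cell i (fromℕ< n<ℓ)) ⟩
    0ℚ                                        ∎
    where open ≡-Reasoning

  balanced⇒inKernel : ∀ {y} → Balanced (rows y) → InKernel A y
  balanced⇒inKernel {y} balanced = every-cell λ i j →
    trans (Σ-neighbours y i j) (balanced i (toℕ j) (Fin.toℕ<n j))

  _≐_ : (ℕ → ℚ) → (ℕ → ℚ) → Set
  f ≐ g = ∀ n → n ℕ.< ℓ → f n ≡ g n

  ℓ-1<ℓ : ℓ-1 ℕ.< ℓ
  ℓ-1<ℓ = ℕ.n<1+n ℓ-1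

  nbrSum-cong : ∀ {h h′} → (∀ i → h i ≐ h′ i) → ∀ i n → n ℕ.< ℓ → nbrSum h i n ≡ nbrSum h′ i n
  nbrSum-cong {h} {h′} h≐h′ i n n<ℓ =
    cong₂ _+_ (cong₂ _+_ (same (h≐h′ i) n n<ℓ) (nxt (h≐h′ (next i)) n n<ℓ)) (prv (h≐h′ (prev i)) n n<ℓ)
    where
    same : ∀ {f g} → f ≐ g → ∀ n → n ℕ.< ℓ → sameRowSum f n ≡ sameRowSum g n
    same f≐g 0             _   = f≐g ℓ-1 ℓ-1<ℓ
    same f≐g 1             _   = f≐g 2 (s≤s (s≤s (s≤s z≤n)))
    same f≐g (suc (suc k)) n<ℓ = cong₂ _+_ (f≐g _ (sucMod-bounded n<ℓ)) (f≐g (suc k) (ℕ.<-trans (ℕ.n<1+n _) n<ℓ))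
    nxt : ∀ {f g} → f ≐ g → ∀ n → n ℕ.< ℓ → nextRowSum f n ≡ nextRowSum g n
    nxt f≐g 0       _   = cong₂ _+_ (f≐g 0 (s≤s z≤n)) (f≐g 1 (s≤s (s≤s z≤n)))
    nxt f≐g (suc k) n<ℓ = f≐g (suc k) n<ℓ
    prv : ∀ {f g} → f ≐ g → ∀ n → n ℕ.< ℓ → prevRowSum f n ≡ prevRowSum g n
    prv f≐g 0             n<ℓ = f≐g 0 n<ℓ
    prv f≐g 1             n<ℓ = cong₂ _+_ (f≐g 1 n<ℓ) (f≐g 0 (s≤s z≤n))
    prv f≐g (suc (suc k)) n<ℓ = f≐g (suc (suc k)) n<ℓ

  nbrSum-sub : ∀ h h′ i n → nbrSum (λ i m → h i m - h′ i m) i n ≡ nbrSum h i n - nbrSum h′ i n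
  nbrSum-sub h h′ i n = begin
    nbrSum (λ i m → h i m - h′ i m) i n
      ≡⟨ cong₂ _+_ (cong₂ _+_ (same (h i) (h′ i) n) (nxt (h (next i)) (h′ (next i)) n))
                   (prv (h (prev i)) (h′ (prev i)) n) ⟩
    (S - S′) + (N - N′) + (P - P′)
      ≡⟨ cong (_+ (P - P′)) (sub-interchange S N S′ N′) ⟩
    (S + N - (S′ + N′)) + (P - P′)
      ≡⟨ sub-interchange (S + N) P (S′ + N′) P′ ⟩
    nbrSum h i n - nbrSum h′ i n ∎
    where
    open ≡-Reasoning
    S S′ N N′ P P′ : ℚ
    S  = sameRowSum (h i) n
    S′ = sameRowSum (h′ i) n
    N  = nextRowSum (h (next i)) n
    N′ = nextRowSum (h′ (next i)) n
    P  = prevRowSum (h (prev i)) n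
    P′ = prevRowSum (h′ (prev i)) n
    same : ∀ f g n → sameRowSum (λ m → f m - g m) n ≡ sameRowSum f n - sameRowSum g n
    same f g 0             = refl
    same f g 1             = refl
    same f g (suc (suc k)) = sub-interchange (f (sucMod ℓ (2 ℕ.+ k))) (f (suc k)) (g (sucMod ℓ (2 ℕ.+ k))) (g (suc k))
    nxt : ∀ f g n → nextRowSum (λ m → f m - g m) n ≡ nextRowSum f n - nextRowSum g n
    nxt f g 0       = sub-interchange (f 0) (f 1) (g 0) (g 1)
    nxt f g (suc k) = refl
    prv : ∀ f g n → prevRowSum (λ m → f m - g m) n ≡ prevRowSum f n - prevRowSum g n
    prv f g 0             = refl
    prv f g 1             = sub-interchange (f 1) (f 0) (g 1) (g 0)
    prv f g (suc (suc k)) = refl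

  nbrSum-rotate : ∀ h i n → nbrSum (h ∘ next) i n ≡ nbrSum h (next i) n
  nbrSum-rotate h 0F n = refl
  nbrSum-rotate h 1F n = refl
  nbrSum-rotate h 2F n = refl

  rotation-difference : (Fin 3 → ℕ → ℚ) → Fin 3 → ℕ → ℚ
  rotation-difference h i n = h i n - h (next i) n

  balanced-rotation-difference : ∀ {h} → Balanced h → Balanced (rotation-difference h)
  balanced-rotation-difference {h} balanced i n n<ℓ = begin
    nbrSum (rotation-difference h) i n        ≡⟨ nbrSum-sub h (h ∘ next) i n ⟩
    nbrSum h i n - nbrSum (h ∘ next) i n      ≡⟨ cong (λ x → nbrSum h i n - x) (nbrSum-rotate h i n) ⟩
    nbrSum h i n - nbrSum h (next i) n        ≡⟨ cong₂ _-_ (balanced i n n<ℓ) (balanced (next i) n n<ℓ) ⟩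
    0ℚ                                        ∎
    where open ≡-Reasoning

  ColumnSumsVanish : (Fin 3 → ℕ → ℚ) → Set
  ColumnSumsVanish h = ∀ i n → h i n + h (next i) n + h (prev i) n ≡ 0ℚ

  rotation-difference-columns : ∀ h → ColumnSumsVanish (rotation-difference h)
  rotation-difference-columns h 0F n = telescope (h 0F n) (h 1F n) (h 2F n)
    where
    telescope : ∀ a b c → (a - b) + (b - c) + (c - a) ≡ 0ℚ
    telescope = solve-∀ ℚ-ring
  rotation-difference-columns h 1F n = rotation-difference-columns (h ∘ next) 0F n
  rotation-difference-columns h 2F n = rotation-difference-columns (h ∘ prev) 0F n

  nbrSum-interior : ∀ h i k → 3 ℕ.+ k ℕ.< ℓ →
    nbrSum h i (2 ℕ.+ k) ≡ h i (3 ℕ.+ k) + h i (1 ℕ.+ k) + h (next i) (2 ℕ.+ k) + h (prev i) (2 ℕ.+ k)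
  nbrSum-interior h i k 3+k<ℓ =
    cong (λ m → h i m + h i (1 ℕ.+ k) + h (next i) (2 ℕ.+ k) + h (prev i) (2 ℕ.+ k)) (sucMod-< 3+k<ℓ)

  nbrSum-last : ∀ h i → nbrSum h i ℓ-1 ≡ h i 0 + h i (1 ℕ.+ ℓ-3) + h (next i) ℓ-1 + h (prev i) ℓ-1
  nbrSum-last h i = cong (λ m → h i m + h i (1 ℕ.+ ℓ-3) + h (next i) ℓ-1 + h (prev i) ℓ-1) (sucMod-last ℓ-1)

  balanced-sign : 2 ∣ ℓ → Balanced (λ _ → sign)
  balanced-sign 2∣ℓ i 0 _ = cong (λ s → s + (1ℚ + - 1ℚ) + 1ℚ) sign-ℓ-1
    where
    sign-ℓ-1 : sign ℓ-1 ≡ - 1ℚ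
    sign-ℓ-1 = trans (sym (neg-involutive (sign ℓ-1))) (cong -_ (sign-even 2∣ℓ))
  balanced-sign 2∣ℓ i 1 _ = refl
  balanced-sign 2∣ℓ i (suc (suc k)) _ = begin
    sign (sucMod ℓ (2 ℕ.+ k)) + s + - s + - s   ≡⟨ cong (λ t → t + s + - s + - s) (sign-sucMod (2 ℕ.+ k) 2∣ℓ) ⟩
    - (- s) + s + - s + - s                     ≡⟨ cancel s ⟩
    0ℚ                                          ∎
    where
    open ≡-Reasoning
    s : ℚ
    s = sign (suc k)
    cancel : ∀ s → - (- s) + s + - s + - s ≡ 0ℚ
    cancel = solve-∀ ℚ-ring

  module _ {h : Fin 3 → ℕ → ℚ} (6∣ℓ : 6 ∣ ℓ) (balanced : Balanced h) (columns : ColumnSumsVanish h) where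

    row-shifted-recurrence : ∀ i k → 3 ℕ.+ k ℕ.< ℓ → h i (3 ℕ.+ k) ≡ h i (2 ℕ.+ k) - h i (1 ℕ.+ k)
    row-shifted-recurrence i k 3+k<ℓ = cancel-column {x = h i (2 ℕ.+ k)}
      (trans (sym (nbrSum-interior h i k 3+k<ℓ)) (balanced i (2 ℕ.+ k) (ℕ.<-trans (ℕ.n<1+n _) 3+k<ℓ)))
      (columns i (2 ℕ.+ k))

    row-wrap : ∀ i → h i 0 ≡ h i ℓ-1 - h i (1 ℕ.+ ℓ-3)
    row-wrap i = cancel-column {x = h i ℓ-1} (trans (sym (nbrSum-last h i)) (balanced i ℓ-1 ℓ-1<ℓ)) (columns i ℓ-1)

    row-ends : ∀ i → h i ℓ-1 ≡ - h i 2 × h i (1 ℕ.+ ℓ-3) ≡ - h i 1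
    row-ends i = recurrence-ends-6∣ {h i ∘ suc} ℓ-3 6∣ℓ (λ j p → row-shifted-recurrence i j (s≤s p))

    row-recurrence : ∀ i j → 2 ℕ.+ j ℕ.< ℓ → h i (2 ℕ.+ j) ≡ h i (1 ℕ.+ j) - h i j
    row-recurrence i zero    _ = solve-for-a₂ (trans (row-wrap i) (cong₂ _-_ (proj₁ (row-ends i)) (proj₂ (row-ends i))))
      where
      solve-for-a₂ : ∀ {a₀ a₁ a₂} → a₀ ≡ - a₂ - - a₁ → a₂ ≡ a₁ - a₀
      solve-for-a₂ {a₁ = a₁} {a₂} refl = identity a₁ a₂
        where
        identity : ∀ x y → y ≡ x - (- y - - x)
        identity = solve-∀ ℚ-ring
    row-recurrence i (suc j) p = row-shifted-recurrence i j p

    column₀-invariant : ∀ i → h (next i) 0 ≡ h i 0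
    column₀-invariant i = sym (subst (λ i′ → h i′ 0 ≡ h (next i) 0) (prev-next i) (at-1 (next i)))
      where
      solve-for-y : ∀ {a₀ a₁ a₂ b c y} → a₂ ≡ a₁ - a₀ → a₂ + b + (c + y) ≡ 0ℚ → a₁ + b + c ≡ 0ℚ → y ≡ a₀
      solve-for-y {a₀} {a₁} {b = b} {c} {y} refl e₁ e₂ = by-zero (identity a₀ a₁ b c y) (cong₂ _-_ e₁ e₂)
        where
        identity : ∀ a₀ a₁ b c y → y ≡ ((a₁ - a₀) + b + (c + y) - (a₁ + b + c)) + a₀
        identity = solve-∀ ℚ-ring
      at-1 : ∀ i → h (prev i) 0 ≡ h i 0
      at-1 i = solve-for-y {a₁ = h i 1} {c = h (prev i) 1} (row-recurrence i 0 (s≤s (s≤s (s≤s z≤n))))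
                           (balanced i 1 (s≤s (s≤s z≤n))) (columns i 1)

    column₁-invariant : ∀ i → h (next i) 1 ≡ h i 1
    column₁-invariant i = solve-for-y (proj₁ (row-ends i)) (row-recurrence i 0 (s≤s (s≤s (s≤s z≤n))))
                                      (balanced i 0 (s≤s z≤n)) (columns i 0)
      where
      solve-for-y : ∀ {a₀ a₁ a₂ aₗ b c y} → aₗ ≡ - a₂ → a₂ ≡ a₁ - a₀ →
                    aₗ + (b + y) + c ≡ 0ℚ → a₀ + b + c ≡ 0ℚ → y ≡ a₁
      solve-for-y {a₀} {a₁} {b = b} {c = c} {y} refl refl e₁ e₂ = by-zero (identity a₀ a₁ b c y) (cong₂ _-_ e₁ e₂)
        where
        identity : ∀ a₀ a₁ b c y → y ≡ (- (a₁ - a₀) + (b + y) + c - (a₀ + b + c)) + a₁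
        identity = solve-∀ ℚ-ring

    balanced-zeroColumns⇒0 : ∀ i n → n ℕ.< ℓ → h i n ≡ 0ℚ
    balanced-zeroColumns⇒0 i = recurrence-vanishing (row-recurrence i) (column-vanishes 0 column₀-invariant i)
                                                                    (column-vanishes 1 column₁-invariant i)
      where
      column-vanishes : ∀ n → (∀ i → h (next i) n ≡ h i n) → ∀ i → h i n ≡ 0ℚ
      column-vanishes n invariant = rotation-invariant⇒0 (λ i → h i n) invariant (columns 0F n)

  balanced⇒alternating : ∀ {h} → 6 ∣ ℓ → Balanced h → ∀ i → h i ≐ (λ n → sign n * h 0F 0)
  balanced⇒alternating {h} 6∣ℓ balanced i n n<ℓ =
    trans (rows-agree i n n<ℓ)
          (cycle-alternating {a} {ℓ-1} recurrence (∣-trans (divides 3 refl) 6∣ℓ) closing n (ℕ.≤-pred n<ℓ))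
    where
    next-agrees : ∀ i → h i ≐ h (next i)
    next-agrees i n n<ℓ = by-zero (identity (h i n) (h (next i) n))
      (balanced-zeroColumns⇒0 6∣ℓ (balanced-rotation-difference balanced) (rotation-difference-columns h) i n n<ℓ)
      where
      identity : ∀ x y → x ≡ (x - y) + y
      identity = solve-∀ ℚ-ring
    rows-agree : ∀ i → h i ≐ h 0F
    rows-agree 0F n n<ℓ = refl
    rows-agree 1F n n<ℓ = sym (next-agrees 0F n n<ℓ)
    rows-agree 2F n n<ℓ = trans (sym (next-agrees 1F n n<ℓ)) (rows-agree 1F n n<ℓ)
    a : ℕ → ℚ
    a = h 0F
    a-balanced : Balanced (λ _ → a)
    a-balanced i n n<ℓ = trans (nbrSum-cong (λ i′ m m<ℓ → sym (rows-agree i′ m m<ℓ)) i n n<ℓ) (balanced i n n<ℓ)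
    recurrence : ∀ j → 2 ℕ.+ j ℕ.≤ ℓ-1 → a (2 ℕ.+ j) + a j + a (1 ℕ.+ j) + a (1 ℕ.+ j) ≡ 0ℚ
    recurrence zero    _     = trans (rearrange (a 0) (a 1) (a 2)) (a-balanced 0F 1 (s≤s (s≤s z≤n)))
      where
      rearrange : ∀ x₀ x₁ x₂ → x₂ + x₀ + x₁ + x₁ ≡ x₂ + x₁ + (x₁ + x₀)
      rearrange = solve-∀ ℚ-ring
    recurrence (suc k) 3+k≤ℓ-1 = trans (sym (nbrSum-interior (λ _ → a) 0F k (s≤s 3+k≤ℓ-1)))
                                        (a-balanced 0F (2 ℕ.+ k) (ℕ.<-trans (ℕ.n<1+n _) (s≤s 3+k≤ℓ-1)))
    closing : a ℓ-1 + (a 0 + a 1) + a 0 ≡ 0ℚ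
    closing = a-balanced 0F 0 (s≤s z≤n)

  alternating : Fin (3 ℕ.* ℓ) → ℚ
  alternating u = sign (toℕ (proj₂ (remQuot {3} ℓ u)))

  alternating-cell : ∀ i j → alternating (cell i j) ≡ sign (toℕ j)
  alternating-cell i j = cong (sign ∘ toℕ ∘ proj₂) (Fin.remQuot-combine {3} {ℓ} i j)

  alternating-inKernel : 2 ∣ ℓ → InKernel A alternating
  alternating-inKernel 2∣ℓ = balanced⇒inKernel {alternating} λ i n n<ℓ →
    trans (nbrSum-cong (λ i′ → rows-alternating i′) i n n<ℓ) (balanced-sign 2∣ℓ i n n<ℓ)
    where
    rows-alternating : ∀ i → rows alternating i ≐ sign
    rows-alternating i n n<ℓ = lookupℕ-≗ sign (alternating-cell i) n<ℓ

  kernel-spanned : 6 ∣ ℓ → ∀ y → InKernel A y → ∃ λ c → ∀ u → y u ≡ c * alternating u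
  kernel-spanned 6∣ℓ y y∈ker = c , every-cell λ i j → begin
    y (cell i j)          ≡⟨ sym (lookupℕ-toℕ (λ j′ → y (cell i j′)) j) ⟩
    rows y i (toℕ j)         ≡⟨ balanced⇒alternating 6∣ℓ (inKernel⇒balanced {y} y∈ker) i (toℕ j) (Fin.toℕ<n j) ⟩
    sign (toℕ j) * c         ≡⟨ ℚ.*-comm (sign (toℕ j)) c ⟩
    c * sign (toℕ j)         ≡⟨ cong (c *_) (sym (alternating-cell i j)) ⟩
    c * alternating (cell i j) ∎
    where
    open ≡-Reasoning
    c : ℚ
    c = rows y 0F 0

  A-sym : ∀ u v → A u v ≡ A v u
  A-sym u v = twistedAdjPair-sym 3 ℓ (remQuot {3} ℓ u) (remQuot {3} ℓ v)

  A-irrefl : ∀ u → A u u ≡ false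
  A-irrefl = every-cell λ i j → trans (A-cell i j i j) (trans (adj-sameRow i j j) (sameRowAdj-irrefl (toℕ j)))
    where
    sameRowAdj-irrefl : ∀ n → sameRowAdj n n ≡ false
    sameRowAdj-irrefl 0             = refl
    sameRowAdj-irrefl 1             = refl
    sameRowAdj-irrefl (suc (suc k)) = cong₂ _∨_
      (≢⇒≡ᵇ-false {2 ℕ.+ k} (sucMod-≢ ℓ (2 ℕ.+ k) (λ ()) (ℕ.1+n≢n ∘ sym) ∘ sym))
      (≢⇒≡ᵇ-false {2 ℕ.+ k} ℕ.1+n≢n)

  edge : ∀ i j i′ j′ → T (twistedAdjPair 3 ℓ (i , j) (i′ , j′)) → T (A (cell i j) (cell i′ j′))
  edge i j i′ j′ = subst T (sym (A-cell i j i′ j′))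

  hub : Fin (3 ℕ.* ℓ)
  hub = cell 0F 1F

  down-row : ∀ i m (1+m<ℓ : suc m ℕ.< ℓ) → Walk A (cell i (fromℕ< 1+m<ℓ)) (cell i 1F)
  down-row i zero    _     = here
  down-row i (suc m) 2+m<ℓ =
    step (edge i (fromℕ< 2+m<ℓ) i (fromℕ< 1+m<ℓ) (subst T (sym adjacent) tt)) (down-row i m 1+m<ℓ)
    where
    1+m<ℓ : suc m ℕ.< ℓ
    1+m<ℓ = ℕ.<-trans (ℕ.n<1+n _) 2+m<ℓ
    adjacent : twistedAdjPair 3 ℓ (i , fromℕ< 2+m<ℓ) (i , fromℕ< 1+m<ℓ) ≡ true
    adjacent = begin
      twistedAdjPair 3 ℓ (i , fromℕ< 2+m<ℓ) (i , fromℕ< 1+m<ℓ)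
        ≡⟨ adj-sameRow i (fromℕ< 2+m<ℓ) (fromℕ< 1+m<ℓ) ⟩
      sameRowAdj (toℕ (fromℕ< 2+m<ℓ)) (toℕ (fromℕ< 1+m<ℓ))
        ≡⟨ cong₂ sameRowAdj (Fin.toℕ-fromℕ< 2+m<ℓ) (Fin.toℕ-fromℕ< 1+m<ℓ) ⟩
      (suc m ≡ᵇ sucMod ℓ (2 ℕ.+ m)) ∨ (suc m ≡ᵇ suc m)
        ≡⟨ cong ((suc m ≡ᵇ sucMod ℓ (2 ℕ.+ m)) ∨_) (≡ᵇ-refl (suc m)) ⟩
      (suc m ≡ᵇ sucMod ℓ (2 ℕ.+ m)) ∨ true
        ≡⟨ Bool.∨-zeroʳ _ ⟩
      true ∎
      where open ≡-Reasoning

  to-hub : ∀ u → Walk A u hub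
  to-hub = every-cell to-hub′
    where
    up : ∀ i → Walk A (cell i 1F) (cell (next i) 1F)
    up i = step (edge i 1F (next i) 1F (subst T (sym (adj-nextRow i 1F 1F)) tt)) here
    along-column : ∀ i → Walk A (cell i 1F) hub
    along-column 0F = here
    along-column 1F = up 1F ◅◅ up 2F
    along-column 2F = up 2F
    to-hub′ : ∀ i j → Walk A (cell i j) hub
    to-hub′ i Fin.zero    = step (edge i 0F (next i) 1F (subst T (sym (adj-nextRow i 0F 1F)) tt)) (along-column (next i))
    to-hub′ i (Fin.suc j) = subst (λ j′ → Walk A (cell i j′) hub) (Fin.fromℕ<-toℕ (Fin.suc j) (Fin.toℕ<n (Fin.suc j)))
                                  (down-row i (toℕ j) (Fin.toℕ<n (Fin.suc j)) ◅◅ along-column i)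

  isNutGraph : 6 ∣ ℓ → IsNutGraph A
  isNutGraph 6∣ℓ =
    (A-sym , A-irrefl) ,
    connected-via-hub A-sym hub to-hub ,
    alternating ,
    alternating-inKernel (∣-trans (divides 3 refl) 6∣ℓ) ,
    every-cell (λ i j → subst (_≢ 0ℚ) (sym (alternating-cell i j)) (sign≢0 (toℕ j))) ,
    kernel-spanned 6∣ℓ

proposition13 : ∀ (ℓ : ℕ) → 6 ∣ ℓ → 6 ≤ ℓ → IsNutGraph (twistedProduct 3 ℓ)
proposition13 ℓ 6∣ℓ 6≤ℓ =
  subst (λ ℓ → IsNutGraph (twistedProduct 3 ℓ)) 3+[ℓ∸3]≡ℓ
        (TwistedC₃.isNutGraph (ℓ ℕ.∸ 3) (subst (6 ∣_) (sym 3+[ℓ∸3]≡ℓ) 6∣ℓ))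
  where
  3+[ℓ∸3]≡ℓ : 3 ℕ.+ (ℓ ℕ.∸ 3) ≡ ℓ
  3+[ℓ∸3]≡ℓ = ℕ.m+[n∸m]≡n (ℕ.m+n≤o⇒n≤o 3 6≤ℓ)
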